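{- Let $G=(V,A)$ be a finite simple directed graph without loops, and let $\pi$ be a directed path in $G$ all of whose arcs are triangularly transitive. Then for every subset $B\subseteq A(\pi)$ of the arcs of $\pi$ (in particular $B=A(\pi)$), the reachability relation is unchanged: $R(G)=R(G\setminus B)$.
   Context: An arc $(x,y)\in A$ is triangularly transitive if there is a vertex $w$ with $(x,w)\in A$ and $(w,y)\in A$. A directed path has pairwise distinct vertices. The reachability relation $R$ of a digraph is defined by $u\,R\,v$ iff $u=v$ or there is a directed walk from $u$ to $v$. $G\setminus B$ denotes the digraph $(V,A\setminus B)$. -}

module Defs where

open import Data.Nat using (ℕ)
open import Data.Fin using (Fin)
open import Data.Bool using (Bool; true; false; T; _∧_; not)
open import Data.List using (List; []; _∷_)
open import Data.List.Relation.Unary.Unique.Propositional using (Unique)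
open import Data.Product using (Σ; ∃; _×_; _,_)
open import Data.Sum using (_⊎_)
open import Relation.Nullary using (¬_)
open import Relation.Binary.PropositionalEquality using (_≡_)
open import Relation.Binary.Construct.Closure.ReflexiveTransitive using (Star)

-- A finite digraph on vertex set Fin n, given by its (finite, decidable) arc set.
-- Simplicity (no multiple arcs) is automatic for an arc relation.
record Digraph (n : ℕ) : Set where
  field
    arc : Fin n → Fin n → Bool

open Digraph public

Arc : ∀ {n} → Digraph n → Fin n → Fin n → Set
Arc G x y = T (arc G x y)

Loopless : ∀ {n} → Digraph n → Set
Loopless G = ∀ x → ¬ Arc G x x

TriangTransitive : ∀ {n} → Digraph n → Fin n → Fin n → Set
TriangTransitive G x y = ∃ λ w → Arc G x w × Arc G w y

data ConsecArc {n : ℕ} : List (Fin n) → Fin n → Fin n → Set where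
  here  : ∀ {x y vs} → ConsecArc (x ∷ y ∷ vs) x y
  there : ∀ {x vs a b} → ConsecArc vs a b → ConsecArc (x ∷ vs) a b

record IsPath {n : ℕ} (G : Digraph n) (π : List (Fin n)) : Set where
  field
    distinct : Unique π
    arcs     : ∀ {x y} → ConsecArc π x y → Arc G x y

PathArc : ∀ {n} → List (Fin n) → Fin n → Fin n → Set
PathArc π x y = ConsecArc π x y

_∖_ : ∀ {n} → Digraph n → (Fin n → Fin n → Bool) → Digraph n
arc (G ∖ B) x y = arc G x y ∧ not (B x y)

Walk : ∀ {n} → Digraph n → Fin n → Fin n → Set
Walk G = Star (Arc G)

Reach : ∀ {n} → Digraph n → Fin n → Fin n → Set
Reach G u v = u ≡ v ⊎ Walk G u v

{-# OPTIONS --safe #-}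
module Submission where

-- An arc (x, y) of π that is removed can be bypassed through a triangle x → w → y.
-- Neither side of the triangle is an arc of π: since π has distinct vertices, its
-- arcs have distinct tails and distinct heads, so (x, w) on π would force w = y and
-- (w, y) on π would force w = x, giving a loop. Hence every arc of G is a walk of
-- length at most two in G ∖ B, and walks of G turn into walks of G ∖ B.

open import Defs
open import Data.Nat using (ℕ)
open import Data.Fin using (Fin)
open import Data.Bool using (Bool; T; true; false)
open import Data.Bool.Properties using (T-∧)
open import Data.List using (List; _∷_)
open import Data.List.Membership.Propositional using (_∈_)
open import Data.List.Relation.Unary.Any using (here; there)
open import Data.List.Relation.Unary.All as All using ()
open import Data.List.Relation.Unary.AllPairs using (_∷_)
open import Data.List.Relation.Unary.Unique.Propositional using (Unique)
open import Data.Product using (_×_; _,_; proj₁)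
open import Data.Sum using (map₂)
open import Function using (Equivalence)
open import Relation.Nullary using (¬_; contradiction; yes; no)
open import Relation.Nullary.Decidable using (T?)
open import Relation.Binary.PropositionalEquality using (_≡_; refl)
open import Relation.Binary.Construct.Closure.ReflexiveTransitive as Star using (ε; _◅_; _⋆)

private
  variable
    n : ℕ
    v x y z : Fin n
    vs π : List (Fin n)

consecArc⇒∈ˡ : ConsecArc vs x y → x ∈ vs
consecArc⇒∈ˡ here      = here refl
consecArc⇒∈ˡ (there c) = there (consecArc⇒∈ˡ c)

consecArc⇒∈ʳ : ConsecArc (v ∷ vs) x y → y ∈ vs
consecArc⇒∈ʳ here                  = here refl
consecArc⇒∈ʳ {vs = _ ∷ _} (there c) = there (consecArc⇒∈ʳ c)

consecArc-functional : Unique π → ConsecArc π x y → ConsecArc π x z → y ≡ z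
consecArc-functional _              here      here      = refl
consecArc-functional (x∉vs ∷ _)     here      (there c) = contradiction refl (All.lookup x∉vs (consecArc⇒∈ˡ c))
consecArc-functional (x∉vs ∷ _)     (there c) here      = contradiction refl (All.lookup x∉vs (consecArc⇒∈ˡ c))
consecArc-functional (_ ∷ distinct) (there c) (there d) = consecArc-functional distinct c d

consecArc-injective : Unique π → ConsecArc π x z → ConsecArc π y z → x ≡ y
consecArc-injective _                here      here      = refl
consecArc-injective (_ ∷ z∉vs ∷ _) here      (there c) = contradiction refl (All.lookup z∉vs (consecArc⇒∈ʳ c))
consecArc-injective (_ ∷ z∉vs ∷ _) (there c) here      = contradiction refl (All.lookup z∉vs (consecArc⇒∈ʳ c))
consecArc-injective (_ ∷ distinct)   (there c) (there d) = consecArc-injective distinct c d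

module _ {n} {G : Digraph n} {π : List (Fin n)} {x y : Fin n}
         (loopless : Loopless G) (distinct : Unique π) (xy∈π : ConsecArc π x y) where

  triangle-first-side-off-path : ∀ {w} → Arc G w y → ¬ ConsecArc π x w
  triangle-first-side-off-path wy xw∈π with consecArc-functional distinct xy∈π xw∈π
  ... | refl = loopless y wy

  triangle-second-side-off-path : ∀ {w} → Arc G x w → ¬ ConsecArc π w y
  triangle-second-side-off-path xw wy∈π with consecArc-injective distinct xy∈π wy∈π
  ... | refl = loopless x xw

∖-intro : (G : Digraph n) (B : Fin n → Fin n → Bool) → Arc G x y → ¬ T (B x y) → Arc (G ∖ B) x y
∖-intro {x = x} {y} G B xy ¬xy∈B with B x y
... | true  = contradiction _ ¬xy∈B
... | false = Equivalence.from T-∧ (xy , _)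

∖-elim : (G : Digraph n) (B : Fin n → Fin n → Bool) → Arc (G ∖ B) x y → Arc G x y
∖-elim G B xy = proj₁ (Equivalence.to T-∧ xy)

arc⇒walk-∖ : (G : Digraph n) → Loopless G → Unique π →
  (∀ {x y} → PathArc π x y → TriangTransitive G x y) →
  (B : Fin n → Fin n → Bool) → (∀ x y → T (B x y) → PathArc π x y) →
  Arc G x y → Walk (G ∖ B) x y
arc⇒walk-∖ {x = x} {y} G loopless distinct triangular B B⊆π xy with T? (B x y)
... | no ¬xy∈B = ∖-intro G B xy ¬xy∈B ◅ ε
... | yes xy∈B with triangular (B⊆π x y xy∈B)
...   | w , xw , wy =
  ∖-intro G B xw (λ xw∈B → triangle-first-side-off-path loopless distinct xy∈π wy (B⊆π x w xw∈B)) ◅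
  ∖-intro G B wy (λ wy∈B → triangle-second-side-off-path loopless distinct xy∈π xw (B⊆π w y wy∈B)) ◅ ε
  where xy∈π = B⊆π x y xy∈B

theorem8 : ∀ {n : ℕ} (G : Digraph n) → Loopless G →
    (π : List (Fin n)) → IsPath G π →
    (∀ {x y} → PathArc π x y → TriangTransitive G x y) →
    (B : Fin n → Fin n → Bool) → (∀ x y → T (B x y) → PathArc π x y) →
    ∀ u v → (Reach G u v → Reach (G ∖ B) u v) × (Reach (G ∖ B) u v → Reach G u v)
theorem8 G loopless π path triangular B B⊆π u v =
  map₂ (arc⇒walk-∖ G loopless (IsPath.distinct path) triangular B B⊆π ⋆) ,
  map₂ (Star.map (∖-elim G B))
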